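{- Let $P$ be a lattice of locally finite height which admits an $R$-grading for some totally ordered set $R$ and which admits an $EL$-labeling. Then the antichain cutsets of $P$ are exactly the level sets of $P$.
   Context: $P$ has locally finite height if every closed interval has finite height. A maximal chain is a chain not properly contained in any other; an antichain cutset is a set meeting every maximal chain in exactly one element. An $R$-grading is a map $\rho:P\to R$ restricting on each maximal chain to an order isomorphism onto $R$; level sets are the nonempty fibres $\{x:\rho(x)=r\}$. Write $x\lessdot y$ if $y$ covers $x$. An edge labeling is a map $\lambda$ from cover relations to a poset $\Lambda$; maximal chains $x_0\lessdot\cdots\lessdot x_k$ of an interval get words $\lambda(x_0\lessdot x_1)\cdots\lambda(x_{k-1}\lessdot x_k)$ and are compared lexicographically; a chain is ascending if $\lambda(x_{i-1}\lessdot x_i)\le\lambda(x_i\lessdot x_{i+1})$ for all $0<i<k$. An $EL$-labeling is an edge labeling such that on every interval $[x,y]$: (1) there is a unique ascending maximal chain; (2) it lexicographically precedes all other maximal chains of $[x,y]$; (3) the lexicographic order on maximal chains of $[x,y]$ has a linear extension that is a well-order. -}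

module Defs where

open import Level using (0ℓ)
open import Data.Nat using (ℕ; _≤ᵇ_) renaming (_≤_ to _≤ℕ_)
open import Data.List using (List; []; _∷_; length)
open import Data.List.Relation.Unary.All using (All)
open import Data.List.Relation.Unary.Linked using (Linked)
open import Data.List.Relation.Binary.Lex.Strict using (Lex-<)
open import Data.Product using (Σ; ∃; ∃-syntax; _×_; _,_; proj₁)
open import Data.Sum using (_⊎_)
open import Data.Empty using (⊥)
open import Relation.Nullary using (¬_)
open import Relation.Unary using (Pred; _⊆_; _∈_)
open import Relation.Binary.Core using (Rel)
open import Relation.Binary.PropositionalEquality using (_≡_; _≢_)
open import Function.Bundles using (_⇔_)

module _ {P : Set} (_≤_ : Rel P 0ℓ) where

  _<_ : Rel P 0ℓ
  x < y = (x ≤ y) × (x ≢ y)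

  Covers : Rel P 0ℓ
  Covers x y = (x < y) × (∀ z → x < z → z < y → ⊥)

  IsChain : Pred P 0ℓ → Set
  IsChain C = ∀ x y → C x → C y → (x ≤ y) ⊎ (y ≤ x)

  IsMaximalChain : Pred P 0ℓ → Set₁
  IsMaximalChain C = IsChain C × (∀ D → IsChain D → C ⊆ D → D ⊆ C)

  IsAntichainCutset : Pred P 0ℓ → Set₁
  IsAntichainCutset A =
    ∀ C → IsMaximalChain C →
      ∃[ x ] ((C x × A x) × (∀ y → C y → A y → y ≡ x))

  FiniteHeightInterval : P → P → Set
  FiniteHeightInterval x y =
    ∃[ n ] (∀ (zs : List P) → Linked _<_ zs →
               All (λ z → (x ≤ z) × (z ≤ y)) zs → length zs ≤ℕ n)

  LocallyFiniteHeight : Set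
  LocallyFiniteHeight = ∀ x y → FiniteHeightInterval x y

  IsGrading : {R : Set} (_≤R_ : Rel R 0ℓ) → (P → R) → Set₁
  IsGrading {R} _≤R_ ρ =
    ∀ C → IsMaximalChain C →
      (∀ x y → C x → C y → (x ≤ y) ⇔ (ρ x ≤R ρ y)) ×
      (∀ r → ∃[ x ] (C x × ρ x ≡ r))

  IsLevelSet : {R : Set} → (P → R) → Pred P 0ℓ → Set
  IsLevelSet {R} ρ A =
    ∃[ r ] (∃[ x ] (ρ x ≡ r) × (∀ x → A x ⇔ (ρ x ≡ r)))

  -- Maximal chains of intervals, given as cover sequences
  -- x = x₀ ⋖ x₁ ⋖ ⋯ ⋖ xₖ : represented by x and the list [x₁ , … , xₖ].

  endpoint : P → List P → P
  endpoint x []       = x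
  endpoint x (z ∷ zs) = endpoint z zs

  IsMaxChainOf : P → P → List P → Set
  IsMaxChainOf x y zs = Linked Covers (x ∷ zs) × (endpoint x zs ≡ y)

  MaxChains : P → P → Set
  MaxChains x y = Σ (List P) (IsMaxChainOf x y)

  module _ {Λ : Set} (_≤Λ_ : Rel Λ 0ℓ) (lab : P → P → Λ) where

    word : P → List P → List Λ
    word x []       = []
    word x (z ∷ zs) = lab x z ∷ word z zs

    _<Λ_ : Rel Λ 0ℓ
    a <Λ b = (a ≤Λ b) × (a ≢ b)

    _<lex_ : Rel (List Λ) 0ℓ
    _<lex_ = Lex-< _≡_ _<Λ_

    Ascending : P → List P → Set
    Ascending x zs = Linked _≤Λ_ (word x zs)

    LexChain : (x : P) → Rel (List P) 0ℓ
    LexChain x zs ws = word x zs <lex word x ws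

    IsWellOrderedLinearExtension : (x y : P) → Rel (List P) 0ℓ → Set₁
    IsWellOrderedLinearExtension x y _⊏_ =
      (∀ zs → IsMaxChainOf x y zs → ¬ (zs ⊏ zs)) ×
      (∀ zs ws vs → IsMaxChainOf x y zs → IsMaxChainOf x y ws →
         IsMaxChainOf x y vs → zs ⊏ ws → ws ⊏ vs → zs ⊏ vs) ×
      (∀ zs ws → IsMaxChainOf x y zs → IsMaxChainOf x y ws →
         (zs ⊏ ws) ⊎ (zs ≡ ws) ⊎ (ws ⊏ zs)) ×
      (∀ zs ws → IsMaxChainOf x y zs → IsMaxChainOf x y ws →
         LexChain x zs ws → zs ⊏ ws) ×
      (∀ (S : Pred (List P) 0ℓ) → S ⊆ IsMaxChainOf x y → (∃[ zs ] S zs) →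
         ∃[ zs ] (S zs × (∀ ws → S ws → ws ≢ zs → zs ⊏ ws)))

    IsELLabeling : Set₁
    IsELLabeling =
      ∀ x y → x ≤ y →
        (∃[ zs ] ((IsMaxChainOf x y zs × Ascending x zs) ×
           (∀ ws → IsMaxChainOf x y ws → Ascending x ws → ws ≡ zs) ×
           (∀ ws → IsMaxChainOf x y ws → ws ≢ zs → LexChain x zs ws)))
        × (Σ (Rel (List P) 0ℓ) (IsWellOrderedLinearExtension x y))

  -- every chain of P extends to a maximal chain (Hausdorff maximal principle)
  ChainsExtendToMaximal : Set₁
  ChainsExtendToMaximal =
    ∀ C → IsChain C → ∃[ D ] (IsMaximalChain D × C ⊆ D)

module Submission where

-- A level set meets every maximal chain exactly once because the grading is
-- an order isomorphism on each maximal chain.  Conversely a cutset A whose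
-- elements all have one common rank is the level set of that rank, so the
-- work is to show that any two elements a, b of A have the same rank.  Put
-- m = a ∧ b and j = a ∨ b.  Every maximal chain of [m, j] meets A (A is an
-- antichain and a cover chain is saturated), and we prove by well-founded
-- induction along the well-ordered linear extension of the lexicographic
-- order that it meets A at the rank r₀ where the ascending chain does.  A
-- non-ascending chain has a descent u ⋖ v ⋖ w; replacing v by the ascending
-- chain of [u, w] gives a lexicographically smaller maximal chain, and since
-- every element strictly between u and w has the rank of v, the rank at
-- which A is met is unchanged.  Since a and b lie on maximal chains of
-- [m, j], both have rank r₀.

open import Defs
open import Level using (0ℓ)
open import Axiom.ExcludedMiddle using (ExcludedMiddle)
open import Algebra.Core using (Op₂)
open import Relation.Unary using (Pred)
open import Relation.Binary.Core using (Rel)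
open import Relation.Binary.Structures using (IsPartialOrder; IsTotalOrder)
open import Relation.Binary.Lattice.Structures using (IsLattice)
open import Relation.Binary.PropositionalEquality using (_≡_)
open import Function.Bundles using (_⇔_)

open import Relation.Binary.Definitions using (Reflexive)
open import Relation.Binary.PropositionalEquality
  using (refl; sym; trans; cong; subst; subst₂; _≢_; ≢-sym)
open import Function.Bundles using (mk⇔; Equivalence)
open import Data.Nat using (suc; s≤s; z≤n) renaming (_≤_ to _≤ℕ_)
open import Data.List using (List; []; _∷_; _++_; length)
open import Data.List.Membership.Propositional using (_∈_)
open import Data.List.Membership.Propositional.Properties using (∈-++⁻; ∈-++⁺ˡ; ∈-++⁺ʳ)
open import Data.List.Relation.Unary.Any using (here; there)
open import Data.List.Relation.Unary.All using (lookup)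
open import Data.List.Relation.Unary.Linked using (Linked; []; [-]; _∷_; head; tail)
import Data.List.Relation.Unary.Linked as Linked
open import Data.List.Relation.Unary.Linked.Properties using (Linked⇒All)
open import Data.List.Relation.Binary.Lex.Strict using (Lex-<; halt; this; next)
open import Data.Product using (∃-syntax; _×_; _,_; proj₁; proj₂)
open import Data.Sum using (_⊎_; inj₁; inj₂)
open import Data.Empty using (⊥-elim)
open import Relation.Nullary using (¬_; Dec; yes; no)

∈-splice : ∀ {A : Set} {y : A} xs ys {ws zs} →
           y ∈ xs ++ ys ++ zs → y ∈ ys ⊎ y ∈ xs ++ ws ++ zs
∈-splice xs ys y∈ with ∈-++⁻ xs y∈
... | inj₁ y∈xs = inj₂ (∈-++⁺ˡ y∈xs)
... | inj₂ y∈rest with ∈-++⁻ ys y∈rest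
...   | inj₁ y∈ys = inj₁ y∈ys
...   | inj₂ y∈zs = inj₂ (∈-++⁺ʳ xs (∈-++⁺ʳ _ y∈zs))

lex-splice : ∀ {A : Set} {_≺_ : Rel A 0ℓ} p {xs ys} → Lex-< _≡_ _≺_ xs ys →
             length ys ≤ℕ length xs → ∀ s t →
             Lex-< _≡_ _≺_ (p ++ xs ++ s) (p ++ ys ++ t)
lex-splice (a ∷ p) xs<ys len s t = next refl (lex-splice p xs<ys len s t)
lex-splice [] halt () s t
lex-splice [] (this x≺y) _ s t = this x≺y
lex-splice [] (next x≡y xs<ys) (s≤s len) s t = next x≡y (lex-splice [] xs<ys len s t)

module Orders {P : Set} {_≤_ : Rel P 0ℓ} (isPO : IsPartialOrder _≡_ _≤_) where
  open IsPartialOrder isPO using (antisym) renaming (refl to ≤-refl; trans to ≤-trans)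

  _≺_ : Rel P 0ℓ
  _≺_ = _<_ _≤_

  _⋖_ : Rel P 0ℓ
  _⋖_ = Covers _≤_

  end : P → List P → P
  end = endpoint _≤_

  ≺-≤-trans : ∀ {x y z} → x ≺ y → y ≤ z → x ≺ z
  ≺-≤-trans (x≤y , x≢y) y≤z = ≤-trans x≤y y≤z , λ { refl → x≢y (antisym x≤y y≤z) }

  covers⇒≤ : ∀ {xs} → Linked _⋖_ xs → Linked _≤_ xs
  covers⇒≤ = Linked.map (λ x⋖y → proj₁ (proj₁ x⋖y))

  linked-head-least : ∀ {x xs y} → Linked _≤_ (x ∷ xs) → y ∈ x ∷ xs → x ≤ y
  linked-head-least L = lookup (Linked⇒All ≤-trans ≤-refl L)

  linked-isChain : ∀ {xs} → Linked _≤_ xs → IsChain _≤_ (_∈ xs)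
  linked-isChain L _ _ (here refl) y∈ = inj₁ (linked-head-least L y∈)
  linked-isChain L _ _ (there x∈) (here refl) = inj₂ (linked-head-least L (there x∈))
  linked-isChain L _ _ (there x∈) (there y∈) = linked-isChain (tail L) _ _ x∈ y∈

  maxChain-isChain : ∀ {x y zs} → IsMaxChainOf _≤_ x y zs → IsChain _≤_ (_∈ x ∷ zs)
  maxChain-isChain (L , _) = linked-isChain (covers⇒≤ L)

  extend-linked : ChainsExtendToMaximal _≤_ → ∀ {xs} → Linked _≤_ xs →
                  ∃[ D ] (IsMaximalChain _≤_ D × (∀ {y} → y ∈ xs → D y))
  extend-linked ext L = ext _ (linked-isChain L)

  end-∈ : ∀ x zs → end x zs ∈ x ∷ zs
  end-∈ x [] = here refl
  end-∈ x (z ∷ zs) = there (end-∈ z zs)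

  end-greatest : ∀ {x zs y} → Linked _≤_ (x ∷ zs) → y ∈ x ∷ zs → y ≤ end x zs
  end-greatest {zs = []} _ (here refl) = ≤-refl
  end-greatest {zs = []} _ (there ())
  end-greatest {zs = z ∷ zs} (x≤z ∷ L) (here refl) = ≤-trans x≤z (end-greatest L (here refl))
  end-greatest {zs = z ∷ zs} (_ ∷ L) (there y∈) = end-greatest L y∈

  cover-chain-strict : ∀ {x zs y} → Linked _⋖_ (x ∷ zs) → y ∈ zs → x ≺ y
  cover-chain-strict [-] ()
  cover-chain-strict (x⋖z ∷ L) y∈ =
    ≺-≤-trans (proj₁ x⋖z) (linked-head-least (covers⇒≤ L) y∈)

  cover-top : ExcludedMiddle 0ℓ → ∀ {u v e} → u ⋖ v → u ≺ e → e ≤ v → e ≡ v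
  cover-top em {v = v} {e} (_ , nothing-between) u≺e e≤v with em {e ≡ v}
  ... | yes e≡v = e≡v
  ... | no e≢v = ⊥-elim (nothing-between _ u≺e (e≤v , e≢v))

  cover-bottom : ExcludedMiddle 0ℓ → ∀ {u v e} → u ⋖ v → u ≤ e → e ≺ v → e ≡ u
  cover-bottom em {u} {e = e} (_ , nothing-between) u≤e e≺v with em {e ≡ u}
  ... | yes e≡u = e≡u
  ... | no e≢u = ⊥-elim (nothing-between _ (u≤e , ≢-sym e≢u) e≺v)

  cover-chain-saturated : ExcludedMiddle 0ℓ → ∀ {x zs d} → Linked _⋖_ (x ∷ zs) →
    (∀ y → y ∈ x ∷ zs → (d ≤ y) ⊎ (y ≤ d)) → x ≤ d → d ≤ end x zs → d ∈ x ∷ zs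
  cover-chain-saturated em {zs = []} _ _ x≤d d≤x = here (antisym d≤x x≤d)
  cover-chain-saturated em {x} {z ∷ zs} {d} (x⋖z ∷ L) comparable x≤d d≤end
    with em {d ≡ x} | comparable z (there (here refl))
  ... | yes d≡x | _ = here d≡x
  ... | no d≢x | inj₁ d≤z = there (here (cover-top em x⋖z (x≤d , ≢-sym d≢x) d≤z))
  ... | no _ | inj₂ z≤d =
    there (cover-chain-saturated em L (λ y y∈ → comparable y (there y∈)) z≤d d≤end)

  end-++ : ∀ x zs ws → end x (zs ++ ws) ≡ end (end x zs) ws
  end-++ x [] ws = refl
  end-++ x (z ∷ zs) ws = end-++ z zs ws

  linked-++ : ∀ {R : Rel P 0ℓ} {x} zs {ws} → Linked R (x ∷ zs) →
              Linked R (end x zs ∷ ws) → Linked R (x ∷ zs ++ ws)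
  linked-++ [] _ L' = L'
  linked-++ (z ∷ zs) (r ∷ L) L' = r ∷ linked-++ zs L L'

  linked-split : ∀ {R : Rel P 0ℓ} {x} zs {ws} → Linked R (x ∷ zs ++ ws) →
                 Linked R (x ∷ zs) × Linked R (end x zs ∷ ws)
  linked-split [] L = [-] , L
  linked-split (z ∷ zs) (r ∷ L) = let (L₁ , L₂) = linked-split zs L in (r ∷ L₁) , L₂

  maxChain-++ : ∀ {x y z} zs {ws} → IsMaxChainOf _≤_ x y zs →
                IsMaxChainOf _≤_ y z ws → IsMaxChainOf _≤_ x z (zs ++ ws)
  maxChain-++ {x} zs {ws} (L , refl) (L' , refl) = linked-++ zs L L' , end-++ x zs ws

  splice : ∀ {x y} pre seg {rest ys} → IsMaxChainOf _≤_ x y (pre ++ seg ++ rest) →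
           IsMaxChainOf _≤_ (end x pre) (end (end x pre) seg) ys →
           IsMaxChainOf _≤_ x y (pre ++ ys ++ rest)
  splice {x} pre seg {rest} (L , refl) ys-max =
    maxChain-++ pre (L-pre , refl) (maxChain-++ _ ys-max (L-rest , sym end-rest))
    where
    L-pre = proj₁ (linked-split pre L)
    L-rest = proj₂ (linked-split seg (proj₂ (linked-split pre L)))
    end-rest : end x (pre ++ seg ++ rest) ≡ end (end (end x pre) seg) rest
    end-rest = trans (end-++ x pre (seg ++ rest)) (end-++ (end x pre) seg rest)

  covers-at : ∀ {x y} pre {v w rest} → IsMaxChainOf _≤_ x y (pre ++ v ∷ w ∷ rest) →
              (end x pre ⋖ v) × (v ⋖ w)
  covers-at pre (L , _) = let L' = proj₂ (linked-split pre L) in head L' , head (tail L')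

  two-covers-≺ : ∀ {u v w} → u ⋖ v → v ⋖ w → u ≺ w
  two-covers-≺ u⋖v v⋖w = ≺-≤-trans (proj₁ u⋖v) (proj₁ (proj₁ v⋖w))

  two-steps : ∀ {u v w ys} → u ⋖ v → v ⋖ w → IsMaxChainOf _≤_ u w ys → 2 ≤ℕ length ys
  two-steps u⋖v v⋖w ([-] , u≡w) = ⊥-elim (proj₂ (two-covers-≺ u⋖v v⋖w) u≡w)
  two-steps u⋖v v⋖w ((u⋖y ∷ [-]) , y≡w) =
    ⊥-elim (proj₂ u⋖y _ (proj₁ u⋖v) (subst (_ ≺_) (sym y≡w) (proj₁ v⋖w)))
  two-steps _ _ (_ ∷ _ ∷ _ , _) = s≤s (s≤s z≤n)

module Labels {P : Set} (_≤_ : Rel P 0ℓ) {Λ : Set} (_≤Λ_ : Rel Λ 0ℓ) (lab : P → P → Λ) where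
  private
    labels : P → List P → List Λ
    labels = word _≤_ _≤Λ_ lab

  word-++ : ∀ x zs ws → labels x (zs ++ ws) ≡ labels x zs ++ labels (endpoint _≤_ x zs) ws
  word-++ x [] ws = refl
  word-++ x (z ∷ zs) ws = cong (lab x z ∷_) (word-++ z zs ws)

  length-word : ∀ x zs → length (labels x zs) ≡ length zs
  length-word x [] = refl
  length-word x (z ∷ zs) = cong suc (length-word z zs)

  record Descent (x : P) (zs : List P) : Set where
    constructor descentAt
    field
      pre : List P
      v w : P
      rest : List P
      shape : zs ≡ pre ++ v ∷ w ∷ rest
      falls : ¬ (lab (endpoint _≤_ x pre) v ≤Λ lab v w)

  descent-∷ : ∀ {x v zs} → Descent v zs → Descent x (v ∷ zs)
  descent-∷ {v = v} (descentAt pre v' w' rest' shape falls) =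
    descentAt (v ∷ pre) v' w' rest' (cong (v ∷_) shape) falls

  descent : ExcludedMiddle 0ℓ → ∀ x zs → ¬ Ascending _≤_ _≤Λ_ lab x zs → Descent x zs
  descent em x [] ¬asc = ⊥-elim (¬asc [])
  descent em x (v ∷ []) ¬asc = ⊥-elim (¬asc [-])
  descent em x (v ∷ w ∷ rest) ¬asc =
    at-first-step em (λ rises → descent em v (w ∷ rest) (λ asc → ¬asc (rises ∷ asc)))
    where
    at-first-step : Dec (lab x v ≤Λ lab v w) →
                    (lab x v ≤Λ lab v w → Descent v (w ∷ rest)) → Descent x (v ∷ w ∷ rest)
    at-first-step (no falls) _ = descentAt [] v w rest refl falls
    at-first-step (yes rises) later = descent-∷ (later rises)

  -- Well-founded induction over the maximal chains of [x, y] along a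
  -- well-ordered linear extension ⊏: a least counterexample cannot exist.
  wo-induction : ExcludedMiddle 0ℓ → ∀ {x y _⊏_} →
    IsWellOrderedLinearExtension _≤_ _≤Λ_ lab x y _⊏_ → (Q : Pred (List P) 0ℓ) →
    (∀ c → IsMaxChainOf _≤_ x y c →
       (∀ c' → IsMaxChainOf _≤_ x y c' → c' ⊏ c → Q c') → Q c) →
    ∀ c → IsMaxChainOf _≤_ x y c → Q c
  wo-induction em {x} {y} {_⊏_} (irreflexive , transitive , _ , _ , least) Q step c mc
    with em {Q c}
  ... | yes Qc = Qc
  ... | no ¬Qc = ⊥-elim (¬Qc₀ (step c₀ mc₀ below-c₀))
    where
    Counterexample : Pred (List P) 0ℓ
    Counterexample c' = IsMaxChainOf _≤_ x y c' × ¬ Q c'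
    minimal = least Counterexample proj₁ (c , mc , ¬Qc)
    c₀ = proj₁ minimal
    mc₀ = proj₁ (proj₁ (proj₂ minimal))
    ¬Qc₀ = proj₂ (proj₁ (proj₂ minimal))
    below-c₀ : ∀ c' → IsMaxChainOf _≤_ x y c' → c' ⊏ c₀ → Q c'
    below-c₀ c' mc' c'⊏c₀ with em {Q c'}
    ... | yes Qc' = Qc'
    ... | no ¬Qc' = ⊥-elim (irreflexive c₀ mc₀ c₀⊏c₀)
      where
      c'≢c₀ : c' ≢ c₀
      c'≢c₀ refl = irreflexive c' mc' c'⊏c₀
      c₀⊏c₀ : c₀ ⊏ c₀
      c₀⊏c₀ = transitive c₀ c' c₀ mc₀ mc' mc₀
                (proj₂ (proj₂ minimal) c' (mc' , ¬Qc') c'≢c₀) c'⊏c₀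

module Grading {P : Set} {_≤_ : Rel P 0ℓ} (isPO : IsPartialOrder _≡_ _≤_)
  (ext : ChainsExtendToMaximal _≤_) (em : ExcludedMiddle 0ℓ)
  {R : Set} (_≤R_ : Rel R 0ℓ) (≤R-refl : Reflexive _≤R_)
  (ρ : P → R) (grad : IsGrading _≤_ _≤R_ ρ) where
  open IsPartialOrder isPO using (antisym)
  open Orders isPO

  _<R_ : Rel R 0ℓ
  _<R_ = _<_ _≤R_

  rank-order : ∀ {C} → IsMaximalChain _≤_ C → ∀ {x y} → C x → C y → (x ≤ y) ⇔ (ρ x ≤R ρ y)
  rank-order mC Cx Cy = proj₁ (grad _ mC) _ _ Cx Cy

  rank-injective : ∀ {C} → IsMaximalChain _≤_ C → ∀ {x y} → C x → C y → ρ x ≡ ρ y → x ≡ y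
  rank-injective mC {x} Cx Cy ρx≡ρy = antisym
    (Equivalence.from (rank-order mC Cx Cy) (subst (ρ x ≤R_) ρx≡ρy ≤R-refl))
    (Equivalence.from (rank-order mC Cy Cx) (subst (_≤R ρ x) ρx≡ρy ≤R-refl))

  rank-strict : ∀ {C} → IsMaximalChain _≤_ C → ∀ {x y} → C x → C y → (x ≺ y) ⇔ (ρ x <R ρ y)
  rank-strict mC Cx Cy = mk⇔
    (λ (x≤y , x≢y) → Equivalence.to (rank-order mC Cx Cy) x≤y ,
                     λ ρx≡ρy → x≢y (rank-injective mC Cx Cy ρx≡ρy))
    (λ (ρx≤ρy , ρx≢ρy) → Equivalence.from (rank-order mC Cx Cy) ρx≤ρy ,
                         λ { refl → ρx≢ρy refl })

  -- If u ⋖ v ⋖ w, every element strictly between u and w has the rank of v: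
  -- on a maximal chain through u ⋖ v ⋖ w, the element of that rank lies
  -- strictly between u and w, hence is v.
  rank-between-covers : ∀ {u v w h} → u ⋖ v → v ⋖ w → u ≺ h → h ≺ w → ρ h ≡ ρ v
  rank-between-covers {u} {v} {w} {h} u⋖v v⋖w u≺h h≺w
    with extend-linked ext (covers⇒≤ (u⋖v ∷ v⋖w ∷ [-]))
       | extend-linked ext (proj₁ u≺h ∷ proj₁ h≺w ∷ [-])
  ... | D , mD , on-D | E , mE , on-E with proj₂ (grad D mD) (ρ h)
  ... | e , De , ρe≡ρh = trans (sym ρe≡ρh) (cong ρ e≡v)
    where
    u∈D = on-D (here refl)
    w∈D = on-D (there (there (here refl)))
    u≺e : u ≺ e
    u≺e = Equivalence.from (rank-strict mD u∈D De) (subst (ρ u <R_) (sym ρe≡ρh)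
            (Equivalence.to (rank-strict mE (on-E (here refl)) (on-E (there (here refl)))) u≺h))
    e≺w : e ≺ w
    e≺w = Equivalence.from (rank-strict mD De w∈D) (subst (_<R ρ w) (sym ρe≡ρh)
            (Equivalence.to (rank-strict mE (on-E (there (here refl)))
                                            (on-E (there (there (here refl))))) h≺w))
    e≡v : e ≡ v
    e≡v with proj₁ mD e v De (on-D (there (here refl)))
    ... | inj₁ e≤v = cover-top em u⋖v u≺e e≤v
    ... | inj₂ v≤e = cover-bottom em v⋖w v≤e e≺w

  level-set⇒cutset : ∀ {A} → IsLevelSet _≤_ ρ A → IsAntichainCutset _≤_ A
  level-set⇒cutset (r , _ , _ , A⇔ρ≡r) C mC with proj₂ (grad C mC) r
  ... | x , Cx , ρx≡r = x , (Cx , Equivalence.from (A⇔ρ≡r x) ρx≡r) ,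
    λ y Cy Ay → rank-injective mC Cy Cx (trans (Equivalence.to (A⇔ρ≡r y) Ay) (sym ρx≡r))

  cutset⇒level-set : ∀ {A} → IsAntichainCutset _≤_ A →
                     (∀ {a b} → A a → A b → ρ a ≡ ρ b) → IsLevelSet _≤_ ρ A
  cutset⇒level-set {A} cut same-rank with extend-linked ext []
  ... | D₀ , mD₀ , _ with cut D₀ mD₀
  ... | a , (_ , Aa) , _ = ρ a , a , refl , λ x → mk⇔ (λ Ax → same-rank Ax Aa) (of-rank x)
    where
    of-rank : ∀ x → ρ x ≡ ρ a → A x
    of-rank x ρx≡ρa with extend-linked ext ([-] {x = x})
    ... | D , mD , on-D with cut D mD
    ... | d , (Dd , Ad) , _ =
      subst A (rank-injective mD Dd (on-D (here refl)) (trans (same-rank Ad Aa) (sym ρx≡ρa))) Ad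

module Cutsets {P : Set} {_≤_ : Rel P 0ℓ} (isPO : IsPartialOrder _≡_ _≤_)
  (ext : ChainsExtendToMaximal _≤_) (em : ExcludedMiddle 0ℓ)
  (A : Pred P 0ℓ) (cut : IsAntichainCutset _≤_ A) where
  open IsPartialOrder isPO using (antisym) renaming (trans to ≤-trans)
  open Orders isPO using (linked-isChain; covers⇒≤; extend-linked; end; end-∈;
                          cover-chain-saturated)

  -- A meets any chain at most once, since the chain extends to a maximal one.
  cutset-unique : ∀ {C} → IsChain _≤_ C → ∀ {h h'} → C h → C h' → A h → A h' → h ≡ h'
  cutset-unique chain Ch Ch' Ah Ah' with ext _ chain
  ... | D , mD , C⊆D with cut D mD
  ... | _ , _ , only = trans (only _ (C⊆D Ch) Ah) (sym (only _ (C⊆D Ch') Ah'))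

  cutset-antichain : ∀ {u v} → A u → A v → u ≤ v → u ≡ v
  cutset-antichain Au Av u≤v =
    cutset-unique (linked-isChain (u≤v ∷ [-])) (here refl) (there (here refl)) Au Av

  -- If A has an element above m and an element below j, then A meets every
  -- maximal chain of [m, j]: the element where A meets a maximal extension
  -- of the chain lies in [m, j] by the antichain property, hence on the
  -- (saturated) chain itself.
  cutset-meets : ∀ {m j a b c} → m ≤ a → A a → b ≤ j → A b →
                 IsMaxChainOf _≤_ m j c → ∃[ h ] (h ∈ m ∷ c × A h)
  cutset-meets {m} {c = c} m≤a Aa b≤j Ab (L , refl)
    with extend-linked ext (covers⇒≤ L)
  ... | D , mD , on-D with cut D mD
  ... | d , (Dd , Ad) , _ = d , d∈c , Ad
    where
    comparable : ∀ y → y ∈ m ∷ c → (d ≤ y) ⊎ (y ≤ d)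
    comparable y y∈ = proj₁ mD d y Dd (on-D y∈)
    d∈c : d ∈ m ∷ c
    d∈c with comparable m (here refl) | comparable (end m c) (end-∈ m c)
    ... | inj₁ d≤m | _ = here (antisym d≤m (subst (m ≤_) (sym d≡a) m≤a))
      where d≡a = cutset-antichain Ad Aa (≤-trans d≤m m≤a)
    ... | inj₂ m≤d | inj₁ d≤end = cover-chain-saturated em L comparable m≤d d≤end
    ... | inj₂ _ | inj₂ end≤d = subst (_∈ m ∷ c) (antisym end≤d d≤end) (end-∈ m c)
      where
      b≡d = cutset-antichain Ab Ad (≤-trans b≤j end≤d)
      d≤end = subst (_≤ end m c) b≡d b≤j

module CutsetRanks (em : ExcludedMiddle 0ℓ)
  {P : Set} {_≤_ : Rel P 0ℓ} (isPO : IsPartialOrder _≡_ _≤_) (ext : ChainsExtendToMaximal _≤_)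
  {R : Set} (_≤R_ : Rel R 0ℓ) (≤R-refl : Reflexive _≤R_)
  (ρ : P → R) (grad : IsGrading _≤_ _≤R_ ρ)
  {Λ : Set} (_≤Λ_ : Rel Λ 0ℓ) (lab : P → P → Λ) (el : IsELLabeling _≤_ _≤Λ_ lab)
  (A : Pred P 0ℓ) (cut : IsAntichainCutset _≤_ A) where
  open IsPartialOrder isPO using () renaming (trans to ≤-trans)
  open Orders isPO
  open Labels _≤_ _≤Λ_ lab
  open Grading isPO ext em _≤R_ ≤R-refl ρ grad using (rank-between-covers)
  open Cutsets isPO ext em A cut using (cutset-unique; cutset-meets)

  module _ {x y : P} (x≤y : x ≤ y) where
    ascending-chain : List P
    ascending-chain = proj₁ (proj₁ (el x y x≤y))

    ascending-max : IsMaxChainOf _≤_ x y ascending-chain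
    ascending-max = proj₁ (proj₁ (proj₂ (proj₁ (el x y x≤y))))

    ascending-asc : Ascending _≤_ _≤Λ_ lab x ascending-chain
    ascending-asc = proj₂ (proj₁ (proj₂ (proj₁ (el x y x≤y))))

    ascending-unique : ∀ ws → IsMaxChainOf _≤_ x y ws → Ascending _≤_ _≤Λ_ lab x ws →
                       ws ≡ ascending-chain
    ascending-unique = proj₁ (proj₂ (proj₂ (proj₁ (el x y x≤y))))

    ascending-first : ∀ ws → IsMaxChainOf _≤_ x y ws → ws ≢ ascending-chain →
                      LexChain _≤_ _≤Λ_ lab x ascending-chain ws
    ascending-first = proj₂ (proj₂ (proj₂ (proj₁ (el x y x≤y))))

    _⊏_ : Rel (List P) 0ℓ
    _⊏_ = proj₁ (proj₂ (el x y x≤y))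

    ⊏-wellOrder : IsWellOrderedLinearExtension _≤_ _≤Λ_ lab x y _⊏_
    ⊏-wellOrder = proj₂ (proj₂ (el x y x≤y))

    ⊏-extends-lex : ∀ zs ws → IsMaxChainOf _≤_ x y zs → IsMaxChainOf _≤_ x y ws →
                    LexChain _≤_ _≤Λ_ lab x zs ws → zs ⊏ ws
    ⊏-extends-lex = proj₁ (proj₂ (proj₂ (proj₂ ⊏-wellOrder)))

  -- Replacing a descent u ⋖ v ⋖ w of a maximal chain by the ascending chain
  -- ys of [u, w] gives a lexicographically smaller chain: ys ≠ v w since v w
  -- is not ascending, so ys precedes v w, and ys is not a prefix of v w.
  shortcut : ∀ {x y} pre {v w rest} → IsMaxChainOf _≤_ x y (pre ++ v ∷ w ∷ rest) →
             ¬ (lab (end x pre) v ≤Λ lab v w) →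
             ∃[ ys ] (IsMaxChainOf _≤_ (end x pre) w ys ×
                      LexChain _≤_ _≤Λ_ lab x (pre ++ ys ++ rest) (pre ++ v ∷ w ∷ rest))
  shortcut {x} pre {v} {w} {rest} mc falls = ys , ys-max , lex
    where
    u = end x pre
    u⋖v = proj₁ (covers-at pre mc)
    v⋖w = proj₂ (covers-at pre mc)
    u≤w = proj₁ (two-covers-≺ u⋖v v⋖w)
    ys = ascending-chain u≤w
    ys-max = ascending-max u≤w
    labels = word _≤_ _≤Λ_ lab
    ys<vw : LexChain _≤_ _≤Λ_ lab u ys (v ∷ w ∷ [])
    ys<vw = ascending-first u≤w (v ∷ w ∷ []) ((u⋖v ∷ v⋖w ∷ [-]) , refl)
      (λ vw≡ys → falls (head (subst (Ascending _≤_ _≤Λ_ lab u) (sym vw≡ys)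
                                     (ascending-asc u≤w))))
    long : 2 ≤ℕ length (labels u ys)
    long = subst (2 ≤ℕ_) (sym (length-word u ys)) (two-steps u⋖v v⋖w ys-max)
    lex : LexChain _≤_ _≤Λ_ lab x (pre ++ ys ++ rest) (pre ++ v ∷ w ∷ rest)
    lex = subst₂ (_<lex_ _≤_ _≤Λ_ lab)
      (sym (trans (word-++ x pre (ys ++ rest)) (cong (labels x pre ++_) (word-++ u ys rest))))
      (sym (word-++ x pre (v ∷ w ∷ rest)))
      (lex-splice (labels x pre) ys<vw long (labels (end u ys) rest) (labels w rest))

  RankOn : R → List P → Set
  RankOn r xs = ∀ h → h ∈ xs → A h → ρ h ≡ r

  -- The rank at which A meets a chain is unchanged by the shortcut: the new
  -- chain loses only v and gains only elements strictly between u and w,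
  -- which have the rank of v.
  transfer-rank : ∀ {m j r} pre {v w rest ys} →
    IsMaxChainOf _≤_ m j (pre ++ v ∷ w ∷ rest) → IsMaxChainOf _≤_ (end m pre) w ys →
    ∃[ h ] (h ∈ m ∷ pre ++ ys ++ rest × A h) →
    RankOn r (m ∷ pre ++ ys ++ rest) → RankOn r (m ∷ pre ++ v ∷ w ∷ rest)
  transfer-rank {m} pre {v} {w} {rest} {ys} mc (L-ys , end≡w) (h' , h'∈new , Ah') rank-new
                h h∈old Ah =
    trans ρh≡ρh' (rank-new h' h'∈new Ah')
    where
    u = end m pre
    u⋖v = proj₁ (covers-at pre mc)
    v⋖w = proj₂ (covers-at pre mc)
    new-max = splice pre (v ∷ w ∷ []) mc (L-ys , end≡w)
    w∈old : w ∈ m ∷ pre ++ v ∷ w ∷ rest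
    w∈old = ∈-++⁺ʳ (m ∷ pre) (there (here refl))
    w∈new : w ∈ m ∷ pre ++ ys ++ rest
    w∈new with subst (_∈ u ∷ ys) end≡w (end-∈ u ys)
    ... | here w≡u = ⊥-elim (proj₂ (two-covers-≺ u⋖v v⋖w) (sym w≡u))
    ... | there w∈ys = ∈-++⁺ʳ (m ∷ pre) (∈-++⁺ˡ w∈ys)
    old-in-new : ∀ {y} → y ∈ m ∷ pre ++ v ∷ w ∷ rest → y ≡ v ⊎ y ∈ m ∷ pre ++ ys ++ rest
    old-in-new y∈ with ∈-splice (m ∷ pre) (v ∷ w ∷ []) y∈
    ... | inj₁ (here y≡v) = inj₁ y≡v
    ... | inj₁ (there (here refl)) = inj₂ w∈new
    ... | inj₂ y∈new = inj₂ y∈new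
    new-in-old : ∀ {y} → y ∈ m ∷ pre ++ ys ++ rest →
                 y ∈ m ∷ pre ++ v ∷ w ∷ rest ⊎ ρ y ≡ ρ v
    new-in-old {y} y∈ with ∈-splice (m ∷ pre) ys y∈
    ... | inj₂ y∈old = inj₁ y∈old
    ... | inj₁ y∈ys with em {y ≡ w}
    ...   | yes refl = inj₁ w∈old
    ...   | no y≢w = inj₂ (rank-between-covers u⋖v v⋖w (cover-chain-strict L-ys y∈ys) (y≤w , y≢w))
      where y≤w = subst (y ≤_) end≡w (end-greatest (covers⇒≤ L-ys) (there y∈ys))
    ρh≡ρh' : ρ h ≡ ρ h'
    ρh≡ρh' with old-in-new h∈old
    ... | inj₂ h∈new = cong ρ (cutset-unique (maxChain-isChain new-max) h∈new h'∈new Ah Ah')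
    ... | inj₁ refl with new-in-old h'∈new
    ...   | inj₁ h'∈old = cong ρ (cutset-unique (maxChain-isChain mc) h∈old h'∈old Ah Ah')
    ...   | inj₂ ρh'≡ρv = sym ρh'≡ρv

  -- If A meets every maximal chain of [m, j], then it meets all of them at
  -- the rank where it meets the ascending chain; by induction along ⊏, a
  -- non-ascending chain inherits this from its shortcut.
  chains-share-rank : ∀ {m j} (m≤j : m ≤ j) →
    (meets : ∀ {c} → IsMaxChainOf _≤_ m j c → ∃[ h ] (h ∈ m ∷ c × A h)) →
    ∀ c → IsMaxChainOf _≤_ m j c → RankOn (ρ (proj₁ (meets (ascending-max m≤j)))) (m ∷ c)
  chains-share-rank {m} m≤j meets =
    wo-induction em (⊏-wellOrder m≤j) (λ c → RankOn r₀ (m ∷ c)) step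
    where
    on-ascending = meets (ascending-max m≤j)
    r₀ = ρ (proj₁ on-ascending)
    rank-ascending : RankOn r₀ (m ∷ ascending-chain m≤j)
    rank-ascending h h∈ Ah =
      cong ρ (cutset-unique (maxChain-isChain (ascending-max m≤j))
                h∈ (proj₁ (proj₂ on-ascending)) Ah (proj₂ (proj₂ on-ascending)))
    step : ∀ c → IsMaxChainOf _≤_ m _ c →
           (∀ c' → IsMaxChainOf _≤_ m _ c' → _⊏_ m≤j c' c → RankOn r₀ (m ∷ c')) →
           RankOn r₀ (m ∷ c)
    step c mc below-c with em {Ascending _≤_ _≤Λ_ lab m c}
    ... | yes asc =
      subst (λ c → RankOn r₀ (m ∷ c)) (sym (ascending-unique m≤j c mc asc)) rank-ascending
    ... | no ¬asc with descent em m c ¬asc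
    ...   | descentAt pre v w rest refl falls with shortcut pre mc falls
    ...     | ys , ys-max , lex =
      transfer-rank pre mc ys-max (meets new-max)
        (below-c _ new-max (⊏-extends-lex m≤j _ _ new-max mc lex))
      where new-max = splice pre (v ∷ w ∷ []) mc ys-max

  -- Any two elements of A in a common interval [m, j] have the same rank:
  -- each lies on a maximal chain of [m, j].
  interval-same-rank : ∀ {m j a b} → m ≤ a → a ≤ j → m ≤ b → b ≤ j → A a → A b → ρ a ≡ ρ b
  interval-same-rank {m} {j} m≤a a≤j m≤b b≤j Aa Ab =
    trans (rank-r₀ m≤a a≤j Aa) (sym (rank-r₀ m≤b b≤j Ab))
    where
    m≤j = ≤-trans m≤a a≤j
    meets : ∀ {c} → IsMaxChainOf _≤_ m j c → ∃[ h ] (h ∈ m ∷ c × A h)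
    meets = cutset-meets m≤a Aa b≤j Ab
    rank-r₀ : ∀ {x} → m ≤ x → x ≤ j → A x → ρ x ≡ ρ (proj₁ (meets (ascending-max m≤j)))
    rank-r₀ {x} m≤x x≤j Ax =
      chains-share-rank m≤j meets _ (maxChain-++ _ lower (ascending-max x≤j)) x x∈ Ax
      where
      lower = ascending-max m≤x
      x∈ : x ∈ m ∷ ascending-chain m≤x ++ ascending-chain x≤j
      x∈ = ∈-++⁺ˡ (subst (_∈ m ∷ ascending-chain m≤x) (proj₂ lower) (end-∈ m _))

corollary3p6 :
    ExcludedMiddle 0ℓ →
    (P : Set) (_≤_ : Rel P 0ℓ) (_∨_ _∧_ : Op₂ P) →
    IsLattice _≡_ _≤_ _∨_ _∧_ →
    ChainsExtendToMaximal _≤_ →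
    LocallyFiniteHeight _≤_ →
    (R : Set) (_≤R_ : Rel R 0ℓ) → IsTotalOrder _≡_ _≤R_ →
    (ρ : P → R) → IsGrading _≤_ _≤R_ ρ →
    (Λ : Set) (_≤Λ_ : Rel Λ 0ℓ) → IsPartialOrder _≡_ _≤Λ_ →
    (lab : P → P → Λ) → IsELLabeling _≤_ _≤Λ_ lab →
    (A : Pred P 0ℓ) →
    IsAntichainCutset _≤_ A ⇔ IsLevelSet _≤_ ρ A
corollary3p6 em P _≤_ _∨_ _∧_ isLattice ext _ R _≤R_ isTotal ρ grad Λ _≤Λ_ _ lab el A =
  mk⇔ (λ cut → cutset⇒level-set cut (same-rank cut)) level-set⇒cutset
  where
  open IsLattice isLattice using (isPartialOrder; supremum; infimum)
  open Grading isPartialOrder ext em _≤R_ (IsTotalOrder.refl isTotal) ρ grad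
    using (cutset⇒level-set; level-set⇒cutset)
  -- a and b lie in the interval [a ∧ b, a ∨ b]
  same-rank : IsAntichainCutset _≤_ A → ∀ {a b} → A a → A b → ρ a ≡ ρ b
  same-rank cut {a} {b} =
    interval-same-rank (proj₁ (infimum a b)) (proj₁ (supremum a b))
                       (proj₁ (proj₂ (infimum a b))) (proj₁ (proj₂ (supremum a b)))
    where
    open CutsetRanks em isPartialOrder ext _≤R_ (IsTotalOrder.refl isTotal) ρ grad _≤Λ_ lab el A cut
      using (interval-same-rank)
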